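{- Let $n\ge1$ and let $\alpha,\beta$ be 0-1 vectors of length $n$. Then the instance $BSM(\alpha,\beta)$ of 3-CCP is consistent if and only if $\sum_i\alpha_i=\sum_i\beta_i$ and $\overleftarrow{\alpha}\succeq\beta$.
   Context: 3-CCP: there are three atom types $A,B,C$ (azure, beige, cyan). An instance of size $N$ gives, for each atom type $a$, a row-sum vector and a column-sum vector of length $N$; a realization is an $N\times N$ matrix with entries in $\{A,B,C,\Box\}$ ($\Box$ = empty) in which row $i$ contains exactly the prescribed number of atoms of type $a$ and column $j$ likewise, for all $a,i,j$; the instance is consistent if it has a realization. The beige skew mirror $BSM(\alpha,\beta)$ is the $(n+2)\times(n+2)$ instance whose azure and cyan sums are all zero and whose beige row sums $x^B$ and column sums $y^B$ are $x^B_i=i-\alpha_i+2$, $y^B_i=i-\beta_i+2$ for $i=1,\dots,n$, and $x^B_i=y^B_i=n+2$ for $i=n+1,n+2$. Reverse: $\overleftarrow{\alpha}_i=\alpha_{n-i+1}$. Minorization: $\alpha\preceq\beta$ (equivalently $\beta\succeq\alpha$) if $\sum_{i=1}^k\alpha_i\le\sum_{i=1}^k\beta_i$ for all $k$. -}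

module Defs where

open import Data.Nat using (ℕ; zero; suc; _+_; _∸_; _≤_; _<_; _<?_)
open import Data.Fin using (Fin; toℕ; fromℕ<; opposite)
open import Data.Bool using (Bool; true; false; if_then_else_)
open import Data.Product using (Σ; _×_)
open import Relation.Nullary using (yes; no)
open import Relation.Binary.PropositionalEquality using (_≡_)

-- atom types: azure, beige, cyan
data Atom : Set where
  A B C : Atom

data Cell : Set where
  atom  : Atom → Cell
  empty : Cell

_==ᵃ_ : Atom → Atom → Bool
A ==ᵃ A = true
B ==ᵃ B = true
C ==ᵃ C = true
_ ==ᵃ _ = false

isAtom : Atom → Cell → Bool
isAtom a (atom b) = a ==ᵃ b
isAtom a empty    = false

Σ[_] : ∀ {N} → (Fin N → ℕ) → ℕ
Σ[_] {zero}  f = 0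
Σ[_] {suc N} f = f Fin.zero + Σ[ (λ i → f (Fin.suc i)) ]

count : ∀ {N} → (Fin N → Bool) → ℕ
count p = Σ[ (λ i → if p i then 1 else 0) ]

record Instance (N : ℕ) : Set where
  field
    rowSum : Atom → Fin N → ℕ
    colSum : Atom → Fin N → ℕ
open Instance public

Matrix : ℕ → Set
Matrix N = Fin N → Fin N → Cell

IsRealization : ∀ {N} → Instance N → Matrix N → Set
IsRealization {N} I M =
  (∀ a i → count (λ j → isAtom a (M i j)) ≡ rowSum I a i) ×
  (∀ a j → count (λ i → isAtom a (M i j)) ≡ colSum I a j)

Consistent : ∀ {N} → Instance N → Set
Consistent {N} I = Σ (Matrix N) (IsRealization I)

ZeroOne : ∀ {n} → (Fin n → ℕ) → Set
ZeroOne α = ∀ i → α i ≤ 1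

-- beige sums of the skew mirror: for 0-based index k < n (paper index i = k+1)
-- the value is i - α_i + 2; for the last two indices it is n + 2
bsmSum : ∀ n → (Fin n → ℕ) → Fin (n + 2) → ℕ
bsmSum n α k with toℕ k <? n
... | yes p = (toℕ k + 1) + 2 ∸ α (fromℕ< p)
... | no _  = n + 2

BSM : ∀ n → (Fin n → ℕ) → (Fin n → ℕ) → Instance (n + 2)
BSM n α β = record { rowSum = rs ; colSum = cs }
  where
  rs : Atom → Fin (n + 2) → ℕ
  rs A _ = 0
  rs B k = bsmSum n α k
  rs C _ = 0
  cs : Atom → Fin (n + 2) → ℕ
  cs A _ = 0
  cs B k = bsmSum n β k
  cs C _ = 0

rev : ∀ {n} → (Fin n → ℕ) → Fin n → ℕ
rev α i = α (opposite i)

prefix : ∀ {n} → (Fin n → ℕ) → ℕ → ℕ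
prefix α k = Σ[ (λ i → if isLess (toℕ i) then α i else 0) ]
  where
  isLess : ℕ → Bool
  isLess m with m <? k
  ... | yes _ = true
  ... | no _  = false

_⪯_ : ∀ {n} → (Fin n → ℕ) → (Fin n → ℕ) → Set
_⪯_ {n} α β = ∀ k → k ≤ n → prefix α k ≤ prefix β k

module Submission where

-- Only beige atoms occur, so a realization of BSM(α, β) is a 0-1 matrix with the prescribed
-- margins. Counting all its ones gives Σα = Σβ. Counting the ones of the first m columns row by
-- row (a row has at most n + 2 − m ones elsewhere), and keeping only the bottom m of the first n
-- rows and the last two rows, which are full, yields exactly β₁ + ⋯ + βₘ ≤ αₙ + ⋯ + αₙ₋ₘ₊₁.
-- Conversely, take the staircase on the first n rows and columns whose row i has its last i cells
-- full (row sums i, column sums j), border it by two full rows and columns, and empty the cells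
-- pairing the ℓ-th one of β (from the left) with the ℓ-th one of α (from the bottom): β ⪯ ←α says
-- precisely that each of these cells lies inside the staircase.

open import Defs
open import Data.Nat using (ℕ; zero; suc; _+_; _*_; _∸_; _⊓_; _≤_; _<_; z≤n; s≤s; z<s; s<s; _≤?_; _<?_; _≟_)
open import Data.Nat.Properties
open import Data.Nat.Tactic.RingSolver using (solve-∀)
open import Data.Fin using (Fin; zero; suc; toℕ; fromℕ<; opposite)
open import Data.Fin.Properties using (toℕ<n; toℕ-fromℕ<; opposite-prop)
open import Data.Bool using (false; if_then_else_)
open import Data.Product using (_×_; _,_)
open import Data.Product.Function.NonDependent.Propositional using (_×-⇔_)
open import Function using (_∘_; flip)
open import Function.Bundles using (_⇔_; mk⇔)
open import Function.Properties.Equivalence using () renaming (trans to ⇔-trans; sym to ⇔-sym)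
open import Relation.Binary.PropositionalEquality
open import Relation.Nullary using (Dec; yes; no; ¬_)
open import Relation.Nullary.Negation using (contradiction)
open import Algebra.Properties.CommutativeSemigroup +-commutativeSemigroup using (interchange; xy∙z≈xz∙y)
open import Algebra.Properties.CommutativeSemigroup *-commutativeSemigroup
  using () renaming (x∙yz≈y∙xz to *-left-comm)

-- g 0 + ⋯ + g (N ∸ 1), defined through Σ[_] so that it meets the sums of Defs definitionally.
∑< : ℕ → (ℕ → ℕ) → ℕ
∑< N g = Σ[ (λ (i : Fin N) → g (toℕ i)) ]

∑<-cong : ∀ N {f g : ℕ → ℕ} → (∀ m → m < N → f m ≡ g m) → ∑< N f ≡ ∑< N g
∑<-cong zero    f≡g = refl
∑<-cong (suc N) f≡g = cong₂ _+_ (f≡g 0 z<s) (∑<-cong N (λ m m<N → f≡g (suc m) (s<s m<N)))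

∑<-mono : ∀ N {f g : ℕ → ℕ} → (∀ m → m < N → f m ≤ g m) → ∑< N f ≤ ∑< N g
∑<-mono zero    f≤g = z≤n
∑<-mono (suc N) f≤g = +-mono-≤ (f≤g 0 z<s) (∑<-mono N (λ m m<N → f≤g (suc m) (s<s m<N)))

∑<-suc : ∀ N g → ∑< (suc N) g ≡ ∑< N g + g N
∑<-suc zero    g = +-comm (g 0) 0
∑<-suc (suc N) g = trans (cong (g 0 +_) (∑<-suc N (g ∘ suc))) (sym (+-assoc (g 0) _ _))

∑<-split : ∀ p q g → ∑< (p + q) g ≡ ∑< p g + ∑< q (λ u → g (p + u))
∑<-split zero    q g = refl
∑<-split (suc p) q g = trans (cong (g 0 +_) (∑<-split p q (g ∘ suc))) (sym (+-assoc (g 0) _ _))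

∑<-split∸ : ∀ {m N} g → m ≤ N → ∑< N g ≡ ∑< m g + ∑< (N ∸ m) (λ u → g (m + u))
∑<-split∸ {m} {N} g m≤N = trans (cong (λ k → ∑< k g) (sym (m+[n∸m]≡n m≤N))) (∑<-split m (N ∸ m) g)

∑<-mono-length : ∀ {m N} g → m ≤ N → ∑< m g ≤ ∑< N g
∑<-mono-length g m≤N = subst (_ ≤_) (sym (∑<-split∸ g m≤N)) (m≤m+n _ _)

∑<-+ : ∀ N f g → ∑< N (λ m → f m + g m) ≡ ∑< N f + ∑< N g
∑<-+ zero    f g = refl
∑<-+ (suc N) f g = trans (cong (f 0 + g 0 +_) (∑<-+ N (f ∘ suc) (g ∘ suc))) (interchange (f 0) (g 0) _ _)

∑<-∸+∑< : ∀ N {f g} → (∀ m → m < N → g m ≤ f m) → ∑< N (λ m → f m ∸ g m) + ∑< N g ≡ ∑< N f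
∑<-∸+∑< N {f} {g} g≤f =
  trans (sym (∑<-+ N (λ m → f m ∸ g m) g)) (∑<-cong N (λ m m<N → m∸n+n≡m (g≤f m m<N)))

∑<-*ˡ : ∀ N x f → ∑< N (λ m → x * f m) ≡ x * ∑< N f
∑<-*ˡ zero    x f = sym (*-zeroʳ x)
∑<-*ˡ (suc N) x f = trans (cong (x * f 0 +_) (∑<-*ˡ N x (f ∘ suc))) (sym (*-distribˡ-+ x (f 0) _))

∑<-const : ∀ N c → ∑< N (λ _ → c) ≡ N * c
∑<-const zero    c = refl
∑<-const (suc N) c = cong (c +_) (∑<-const N c)

∑<-zeros : ∀ N → ∑< N (λ _ → 0) ≡ 0
∑<-zeros N = trans (∑<-const N 0) (*-zeroʳ N)

∑<-ones : ∀ N → ∑< N (λ _ → 1) ≡ N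
∑<-ones N = trans (∑<-const N 1) (*-identityʳ N)

∑<-binary≤ : ∀ N {f} → (∀ m → m < N → f m ≤ 1) → ∑< N f ≤ N
∑<-binary≤ N {f} f≤1 = subst (∑< N f ≤_) (∑<-ones N) (∑<-mono N f≤1)

∑<-comm : ∀ p q (F : ℕ → ℕ → ℕ) → ∑< p (λ j → ∑< q (λ i → F i j)) ≡ ∑< q (λ i → ∑< p (F i))
∑<-comm zero    q F = sym (∑<-zeros q)
∑<-comm (suc p) q F = trans (cong (∑< q (λ i → F i 0) +_) (∑<-comm p q (λ i → F i ∘ suc)))
                            (sym (∑<-+ q (λ i → F i 0) (λ i → ∑< p (F i ∘ suc))))

mirror : ℕ → ℕ → ℕ
mirror n t = n ∸ suc t

mirror< : ∀ {n t} → t < n → mirror n t < n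
mirror< {suc n} {t} _ = s≤s (m∸n≤m n t)

mirror-involutive : ∀ {n t} → t < n → mirror n (mirror n t) ≡ t
mirror-involutive {suc n} (s≤s t≤n) = m∸[m∸n]≡n t≤n

∑<-mirror : ∀ n g → ∑< n (g ∘ mirror n) ≡ ∑< n g
∑<-mirror zero    g = refl
∑<-mirror (suc n) g = trans (+-comm (g n) _) (trans (cong (_+ g n) (∑<-mirror n g)) (sym (∑<-suc n g)))

𝟙[_] : {P : Set} → Dec P → ℕ
𝟙[ yes _ ] = 1
𝟙[ no _ ]  = 0

𝟙-yes : {P : Set} {d : Dec P} → P → 𝟙[ d ] ≡ 1
𝟙-yes {d = yes _} _ = refl
𝟙-yes {d = no ¬p} p = contradiction p ¬p

𝟙-no : {P : Set} {d : Dec P} → ¬ P → 𝟙[ d ] ≡ 0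
𝟙-no {d = yes p} ¬p = contradiction p ¬p
𝟙-no {d = no _}  _  = refl

𝟙≤1 : {P : Set} (d : Dec P) → 𝟙[ d ] ≤ 1
𝟙≤1 (yes _) = s≤s z≤n
𝟙≤1 (no _)  = z≤n

𝟙-⇔ : {P Q : Set} {p : Dec P} {q : Dec Q} → (P → Q) → (Q → P) → 𝟙[ p ] ≡ 𝟙[ q ]
𝟙-⇔ {p = yes P} {q = yes _} _   _   = refl
𝟙-⇔ {p = yes P} {q = no ¬Q} P→Q _   = contradiction (P→Q P) ¬Q
𝟙-⇔ {p = no ¬P} {q = yes Q} _   Q→P = contradiction (Q→P Q) ¬P
𝟙-⇔ {p = no _}  {q = no _}  _   _   = refl

binary-*ˡ : ∀ {x y z} → x ≤ 1 → (x ≡ 1 → y ≡ z) → x * y ≡ x * z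
binary-*ˡ z≤n       _     = refl
binary-*ˡ (s≤s z≤n) 1⇒y≡z = cong (1 *_) (1⇒y≡z refl)

∑<-𝟙[≤?]ʳ : ∀ m t → ∑< m (λ j → 𝟙[ t ≤? j ]) ≡ m ∸ t
∑<-𝟙[≤?]ʳ zero    t = sym (0∸n≡0 t)
∑<-𝟙[≤?]ʳ (suc m) t =
  trans (∑<-suc m (λ j → 𝟙[ t ≤? j ])) (trans (cong (_+ 𝟙[ t ≤? m ]) (∑<-𝟙[≤?]ʳ m t)) step)
  where
  step : m ∸ t + 𝟙[ t ≤? m ] ≡ suc m ∸ t
  step with t ≤? m
  ... | yes t≤m = trans (+-comm _ 1) (sym (+-∸-assoc 1 t≤m))
  ... | no  t≰m = trans (+-identityʳ _) (trans (m≤n⇒m∸n≡0 (<⇒≤ m<t)) (sym (m≤n⇒m∸n≡0 m<t)))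
    where m<t = ≰⇒> t≰m

∑<-𝟙[≤?]ˡ : ∀ m j → ∑< m (λ t → 𝟙[ t ≤? j ]) ≡ m ⊓ suc j
∑<-𝟙[≤?]ˡ zero    j = refl
∑<-𝟙[≤?]ˡ (suc m) j =
  trans (∑<-suc m (λ t → 𝟙[ t ≤? j ])) (trans (cong (_+ 𝟙[ m ≤? j ]) (∑<-𝟙[≤?]ˡ m j)) step)
  where
  step : m ⊓ suc j + 𝟙[ m ≤? j ] ≡ suc (m ⊓ j)
  step with m ≤? j
  ... | yes m≤j = trans (cong (_+ 1) (m≤n⇒m⊓n≡m (m≤n⇒m≤1+n m≤j)))
                        (trans (+-comm m 1) (cong suc (sym (m≤n⇒m⊓n≡m m≤j))))
  ... | no  m≰j = trans (+-identityʳ _)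
                        (trans (m≥n⇒m⊓n≡n j<m) (cong suc (sym (m≥n⇒m⊓n≡n (<⇒≤ j<m)))))
    where j<m = ≰⇒> m≰j

rank : (ℕ → ℕ) → ℕ → ℕ
rank d j = ∑< (suc j) d

∑<-rank≟ : ∀ {d} → (∀ j → d j ≤ 1) → ∀ m {s} → 1 ≤ s →
           ∑< m (λ j → d j * 𝟙[ rank d j ≟ s ]) ≡ 𝟙[ s ≤? ∑< m d ]
∑<-rank≟ d-binary zero    1≤s = sym (𝟙-no (<⇒≱ 1≤s))
∑<-rank≟ {d} d-binary (suc m) {s} 1≤s = begin
  ∑< (suc m) hits                                  ≡⟨ ∑<-suc m hits ⟩
  ∑< m hits + hits m                               ≡⟨ cong (_+ hits m) (∑<-rank≟ d-binary m 1≤s) ⟩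
  𝟙[ s ≤? ∑< m d ] + d m * 𝟙[ rank d m ≟ s ]       ≡⟨ cong (λ x → 𝟙[ s ≤? ∑< m d ] + d m * 𝟙[ x ≟ s ])
                                                           (∑<-suc m d) ⟩
  𝟙[ s ≤? ∑< m d ] + d m * 𝟙[ ∑< m d + d m ≟ s ]   ≡⟨ step (∑< m d) (d m) (d-binary m) ⟩
  𝟙[ s ≤? ∑< m d + d m ]                           ≡⟨ cong (λ x → 𝟙[ s ≤? x ]) (sym (∑<-suc m d)) ⟩
  𝟙[ s ≤? ∑< (suc m) d ]                           ∎
  where
  open ≡-Reasoning
  hits : ℕ → ℕ
  hits j = d j * 𝟙[ rank d j ≟ s ]
  step : ∀ S e → e ≤ 1 → 𝟙[ s ≤? S ] + e * 𝟙[ S + e ≟ s ] ≡ 𝟙[ s ≤? S + e ]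
  step S zero          _         = trans (+-identityʳ _) (cong (λ x → 𝟙[ s ≤? x ]) (sym (+-identityʳ S)))
  step S (suc (suc e)) (s≤s ())
  step S 1             _ with s ≤? S
  ... | yes s≤S = trans (cong (λ x → 1 + (x + 0)) (𝟙-no {d = S + 1 ≟ s} S+1≢s))
                        (sym (𝟙-yes {d = s ≤? S + 1} (≤-trans s≤S (m≤m+n S 1))))
    where
    S+1≢s : S + 1 ≢ s
    S+1≢s S+1≡s = <⇒≱ (m<m+n S z<s) (subst (_≤ S) (sym S+1≡s) s≤S)
  ... | no  s≰S = trans (+-identityʳ 𝟙[ S + 1 ≟ s ])
                        (𝟙-⇔ (λ S+1≡s → ≤-reflexive (sym S+1≡s))
                             (λ s≤S+1 → ≤-antisym (subst (_≤ s) (+-comm 1 S) (≰⇒> s≰S)) s≤S+1))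

matching : (ℕ → ℕ) → (ℕ → ℕ) → ℕ → ℕ → ℕ
matching c d i j = c i * (d j * 𝟙[ rank d j ≟ rank c i ])

matching-transpose : ∀ c d i j → matching c d i j ≡ matching d c j i
matching-transpose c d i j =
  trans (*-left-comm (c i) (d j) _) (cong (λ x → d j * (c i * x)) (𝟙-⇔ sym sym))

matching-binary : ∀ {c d} → (∀ i → c i ≤ 1) → (∀ j → d j ≤ 1) → ∀ i j → matching c d i j ≤ 1
matching-binary {c} {d} c-binary d-binary i j =
  *-mono-≤ (c-binary i) (*-mono-≤ (d-binary j) (𝟙≤1 (rank d j ≟ rank c i)))

∑<-matching : ∀ {n c d} → (∀ i → c i ≤ 1) → (∀ j → d j ≤ 1) → ∑< n c ≡ ∑< n d →
              ∀ {i} → i < n → ∑< n (matching c d i) ≡ c i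
∑<-matching {n} {c} {d} c-binary d-binary ∑c≡∑d {i} i<n = begin
  ∑< n (matching c d i)                               ≡⟨ ∑<-*ˡ n (c i) (λ j → d j * 𝟙[ rank d j ≟ rank c i ]) ⟩
  c i * ∑< n (λ j → d j * 𝟙[ rank d j ≟ rank c i ])   ≡⟨ binary-*ˡ (c-binary i) partner ⟩
  c i * 1                                             ≡⟨ *-identityʳ (c i) ⟩
  c i                                                 ∎
  where
  open ≡-Reasoning
  partner : c i ≡ 1 → ∑< n (λ j → d j * 𝟙[ rank d j ≟ rank c i ]) ≡ 1
  partner cᵢ≡1 = trans (∑<-rank≟ d-binary n 1≤rank) (𝟙-yes rank≤∑d)
    where
    1≤rank : 1 ≤ rank c i
    1≤rank = subst (1 ≤_) (sym (trans (∑<-suc i c) (cong (∑< i c +_) cᵢ≡1))) (m≤n+m 1 _)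
    rank≤∑d : rank c i ≤ ∑< n d
    rank≤∑d = subst (rank c i ≤_) ∑c≡∑d (∑<-mono-length c i<n)

module Staircase {n : ℕ} {u v : ℕ → ℕ} (u-binary : ∀ t → u t ≤ 1) (v-binary : ∀ j → v j ≤ 1)
                 (∑u≡∑v : ∑< n u ≡ ∑< n v) (v≼u : ∀ {m} → m ≤ n → ∑< m v ≤ ∑< m u) where

  -- Dominance of v by u puts the ℓ-th one of u no later than the ℓ-th one of v.
  matching-below-diagonal : ∀ {t j} → j < t → j < n → matching u v t j ≡ 0
  matching-below-diagonal {t} {j} j<t j<n = trans (binary-*ˡ (u-binary t) unmatched) (*-zeroʳ (u t))
    where
    unmatched : u t ≡ 1 → v j * 𝟙[ rank v j ≟ rank u t ] ≡ 0
    unmatched uₜ≡1 = trans (cong (v j *_) (𝟙-no (<⇒≢ rank<rank))) (*-zeroʳ (v j))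
      where
      open ≤-Reasoning
      rank<rank : rank v j < rank u t
      rank<rank = begin-strict
        ∑< (suc j) v  ≤⟨ v≼u j<n ⟩
        ∑< (suc j) u  ≤⟨ ∑<-mono-length u j<t ⟩
        ∑< t u        <⟨ m<m+n (∑< t u) z<s ⟩
        ∑< t u + 1    ≡⟨ cong (∑< t u +_) (sym uₜ≡1) ⟩
        ∑< t u + u t  ≡⟨ sym (∑<-suc t u) ⟩
        ∑< (suc t) u  ∎

  matching≤𝟙 : ∀ {t j} → j < n → matching u v t j ≤ 𝟙[ t ≤? j ]
  matching≤𝟙 {t} {j} j<n with t ≤? j
  ... | yes _   = matching-binary u-binary v-binary t j
  ... | no  t≰j = ≤-reflexive (matching-below-diagonal (≰⇒> t≰j) j<n)

  staircase : ℕ → ℕ → ℕ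
  staircase t j = 𝟙[ t ≤? j ] ∸ matching u v t j

  staircase-binary : ∀ t j → staircase t j ≤ 1
  staircase-binary t j = ≤-trans (m∸n≤m _ (matching u v t j)) (𝟙≤1 (t ≤? j))

  ∑<-staircase-row : ∀ {t} → t < n → ∑< n (staircase t) + u t ≡ n ∸ t
  ∑<-staircase-row {t} t<n = begin
    ∑< n (staircase t) + u t                    ≡⟨ cong (∑< n (staircase t) +_)
                                                        (sym (∑<-matching u-binary v-binary ∑u≡∑v t<n)) ⟩
    ∑< n (staircase t) + ∑< n (matching u v t)  ≡⟨ ∑<-∸+∑< n (λ j j<n → matching≤𝟙 {t} j<n) ⟩
    ∑< n (λ j → 𝟙[ t ≤? j ])                    ≡⟨ ∑<-𝟙[≤?]ʳ n t ⟩
    n ∸ t                                       ∎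
    where open ≡-Reasoning

  ∑<-staircase-col : ∀ {j} → j < n → ∑< n (λ t → staircase t j) + v j ≡ suc j
  ∑<-staircase-col {j} j<n = begin
    ∑< n (λ t → staircase t j) + v j                            ≡⟨ cong (∑< n (λ t → staircase t j) +_) (sym column) ⟩
    ∑< n (λ t → staircase t j) + ∑< n (λ t → matching u v t j)  ≡⟨ ∑<-∸+∑< n (λ t _ → matching≤𝟙 {t} j<n) ⟩
    ∑< n (λ t → 𝟙[ t ≤? j ])                                    ≡⟨ ∑<-𝟙[≤?]ˡ n j ⟩
    n ⊓ suc j                                                   ≡⟨ m≥n⇒m⊓n≡n j<n ⟩
    suc j                                                       ∎
    where
    open ≡-Reasoning
    column : ∑< n (λ t → matching u v t j) ≡ v j
    column = trans (∑<-cong n (λ t _ → matching-transpose u v t j))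
                   (∑<-matching v-binary u-binary (sym ∑u≡∑v) j<n)

record BinaryMatrix (N : ℕ) (R C : ℕ → ℕ) : Set where
  field
    entry   : ℕ → ℕ → ℕ
    binary  : ∀ r c → entry r c ≤ 1
    rowSums : ∀ {r} → r < N → ∑< N (entry r) ≡ R r
    colSums : ∀ {c} → c < N → ∑< N (λ r → entry r c) ≡ C c

module _ {N R C} (M : BinaryMatrix N R C) where
  open BinaryMatrix M

  ∑rowSums≡∑colSums : ∑< N R ≡ ∑< N C
  ∑rowSums≡∑colSums = begin
    ∑< N R                                   ≡⟨ ∑<-cong N (λ r r<N → sym (rowSums r<N)) ⟩
    ∑< N (λ r → ∑< N (entry r))              ≡⟨ sym (∑<-comm N N entry) ⟩
    ∑< N (λ c → ∑< N (λ r → entry r c))      ≡⟨ ∑<-cong N (λ c c<N → colSums c<N) ⟩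
    ∑< N C                                   ∎
    where open ≡-Reasoning

  -- A row with sum R r has at least R r ∸ (N ∸ m) of its ones among the first m columns.
  ∑rowSums∸≤∑colSums : ∀ {m} → m ≤ N → ∑< N (λ r → R r ∸ (N ∸ m)) ≤ ∑< m C
  ∑rowSums∸≤∑colSums {m} m≤N = begin
    ∑< N (λ r → R r ∸ (N ∸ m))               ≤⟨ ∑<-mono N (λ r r<N → m≤n+o⇒m∸n≤o (R r) (N ∸ m)
                                                                                     (row-split r<N)) ⟩
    ∑< N (λ r → ∑< m (entry r))              ≡⟨ sym (∑<-comm m N entry) ⟩
    ∑< m (λ c → ∑< N (λ r → entry r c))      ≡⟨ ∑<-cong m (λ c c<m → colSums (<-≤-trans c<m m≤N)) ⟩
    ∑< m C                                   ∎
    where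
    open ≤-Reasoning
    row-split : ∀ {r} → r < N → R r ≤ (N ∸ m) + ∑< m (entry r)
    row-split {r} r<N = begin
      R r                                                    ≡⟨ sym (rowSums r<N) ⟩
      ∑< N (entry r)                                         ≡⟨ ∑<-split∸ (entry r) m≤N ⟩
      ∑< m (entry r) + ∑< (N ∸ m) (λ u → entry r (m + u))    ≤⟨ +-monoʳ-≤ (∑< m (entry r))
                                                                   (∑<-binary≤ (N ∸ m) (λ u _ → binary r (m + u))) ⟩
      ∑< m (entry r) + (N ∸ m)                               ≡⟨ +-comm (∑< m (entry r)) (N ∸ m) ⟩
      (N ∸ m) + ∑< m (entry r)                               ∎

bordered : ℕ → (ℕ → ℕ → ℕ) → ℕ → ℕ → ℕ
bordered n H r c with r <? n | c <? n
... | yes _ | yes _ = H r c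
... | _     | _     = 1

bordered-transpose : ∀ n H r c → bordered n H r c ≡ bordered n (flip H) c r
bordered-transpose n H r c with r <? n | c <? n
... | yes _ | yes _ = refl
... | yes _ | no _  = refl
... | no _  | yes _ = refl
... | no _  | no _  = refl

bordered-binary : ∀ n {H} → (∀ r c → H r c ≤ 1) → ∀ r c → bordered n H r c ≤ 1
bordered-binary n H-binary r c with r <? n | c <? n
... | yes _ | yes _ = H-binary r c
... | yes _ | no _  = ≤-refl
... | no _  | _     = ≤-refl

bordered-inner : ∀ {n H r c} → r < n → c < n → bordered n H r c ≡ H r c
bordered-inner {n} {r = r} {c} r<n c<n with r <? n | c <? n
... | yes _   | yes _   = refl
... | no r≮n  | _       = contradiction r<n r≮n
... | yes _   | no c≮n  = contradiction c<n c≮n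

bordered-outerʳ : ∀ {n H r c} → n ≤ c → bordered n H r c ≡ 1
bordered-outerʳ {n} {r = r} {c} n≤c with r <? n | c <? n
... | yes _ | yes c<n = contradiction n≤c (<⇒≱ c<n)
... | yes _ | no _    = refl
... | no _  | _       = refl

bordered-outerˡ : ∀ {n H r c} → n ≤ r → bordered n H r c ≡ 1
bordered-outerˡ {n} {H} {r} {c} n≤r = trans (bordered-transpose n H r c) (bordered-outerʳ n≤r)

∑<-bordered-inner : ∀ {n d H r} → r < n → ∑< (n + d) (bordered n H r) ≡ ∑< n (H r) + d
∑<-bordered-inner {n} {d} {H} {r} r<n = begin
  ∑< (n + d) (bordered n H r)                                  ≡⟨ ∑<-split n d (bordered n H r) ⟩
  ∑< n (bordered n H r) + ∑< d (λ u → bordered n H r (n + u))  ≡⟨ cong₂ _+_ (∑<-cong n inner) (∑<-cong d border) ⟩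
  ∑< n (H r) + ∑< d (λ _ → 1)                                  ≡⟨ cong (∑< n (H r) +_) (∑<-ones d) ⟩
  ∑< n (H r) + d                                               ∎
  where
  open ≡-Reasoning
  inner : ∀ c → c < n → bordered n H r c ≡ H r c
  inner c c<n = bordered-inner r<n c<n
  border : ∀ u → u < d → bordered n H r (n + u) ≡ 1
  border u _ = bordered-outerʳ (m≤m+n n u)

∑<-bordered-outer : ∀ {n N H r} → n ≤ r → ∑< N (bordered n H r) ≡ N
∑<-bordered-outer {N = N} n≤r = trans (∑<-cong N (λ c _ → bordered-outerˡ {c = c} n≤r)) (∑<-ones N)

∑<-bordered-transpose : ∀ n N H c → ∑< N (λ r → bordered n H r c) ≡ ∑< N (bordered n (flip H) c)
∑<-bordered-transpose n N H c = ∑<-cong N (λ r _ → bordered-transpose n H r c)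

bsmMargin : ℕ → (ℕ → ℕ) → ℕ → ℕ
bsmMargin n a r with r <? n
... | yes _ = r + 1 + 2 ∸ a r
... | no _  = n + 2

bsmMargin-inner : ∀ {n a r} → a r ≤ 1 → r < n → bsmMargin n a r + a r ≡ r + 1 + 2
bsmMargin-inner {n} {a} {r} aᵣ≤1 r<n with r <? n
... | yes _   = m∸n+n≡m (≤-trans aᵣ≤1 (≤-trans (m≤n+m 1 r) (m≤m+n (r + 1) 2)))
... | no r≮n  = contradiction r<n r≮n

bsmMargin-outer : ∀ {n a r} → n ≤ r → bsmMargin n a r ≡ n + 2
bsmMargin-outer {n} {a} {r} n≤r with r <? n
... | yes r<n = contradiction n≤r (<⇒≱ r<n)
... | no _    = refl

bsmMargin-from : ∀ {n a r s} → a r ≤ 1 → r < n → s + a r ≡ suc r → s + 2 ≡ bsmMargin n a r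
bsmMargin-from {n} {a} {r} {s} aᵣ≤1 r<n s+aᵣ≡1+r = +-cancelʳ-≡ (a r) (s + 2) (bsmMargin n a r) (begin
  s + 2 + a r            ≡⟨ xy∙z≈xz∙y s 2 (a r) ⟩
  s + a r + 2            ≡⟨ cong (_+ 2) (trans s+aᵣ≡1+r (+-comm 1 r)) ⟩
  r + 1 + 2              ≡⟨ sym (bsmMargin-inner aᵣ≤1 r<n) ⟩
  bsmMargin n a r + a r  ∎)
  where open ≡-Reasoning

∸-+-cancel : ∀ {x y z w} → x + y ≡ z + w → y ≤ w → (x ∸ z) + y ≡ w
∸-+-cancel {x} {y} {z} {w} x+y≡z+w y≤w = begin
  (x ∸ z) + y            ≡⟨ cong (λ v → (v ∸ z) + y) x≡z+[w∸y] ⟩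
  (z + (w ∸ y) ∸ z) + y  ≡⟨ cong (_+ y) (m+n∸m≡n z (w ∸ y)) ⟩
  (w ∸ y) + y            ≡⟨ m∸n+n≡m y≤w ⟩
  w                      ∎
  where
  open ≡-Reasoning
  x≡z+[w∸y] : x ≡ z + (w ∸ y)
  x≡z+[w∸y] = +-cancelʳ-≡ y x (z + (w ∸ y))
    (trans x+y≡z+w (trans (cong (z +_) (sym (m∸n+n≡m y≤w))) (sym (+-assoc z (w ∸ y) y))))

≤-from-sums : ∀ {e s p x b c} → e + s ≡ p → x + b ≡ p + c → e + c ≤ x → b ≤ s
≤-from-sums {e} {s} {p} {x} {b} {c} e+s≡p x+b≡p+c e+c≤x = +-cancelˡ-≤ (e + c) b s (begin
  e + c + b  ≤⟨ +-monoˡ-≤ b e+c≤x ⟩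
  x + b      ≡⟨ x+b≡p+c ⟩
  p + c      ≡⟨ cong (_+ c) (sym e+s≡p) ⟩
  e + s + c  ≡⟨ xy∙z≈xz∙y e s c ⟩
  e + c + s  ∎)
  where open ≤-Reasoning

∑<-block≤ : ∀ {m n} g → m ≤ n → ∑< m (λ u → g ((n ∸ m) + u)) ≤ ∑< n g
∑<-block≤ {m} {n} g m≤n = begin
  ∑< m (λ u → g ((n ∸ m) + u))                     ≤⟨ m≤n+m _ (∑< (n ∸ m) g) ⟩
  ∑< (n ∸ m) g + ∑< m (λ u → g ((n ∸ m) + u))      ≡⟨ sym (∑<-split (n ∸ m) m g) ⟩
  ∑< (n ∸ m + m) g                                 ≡⟨ cong (λ k → ∑< k g) (m∸n+n≡m m≤n) ⟩
  ∑< n g                                           ∎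
  where open ≤-Reasoning

∑<-block-mirror : ∀ {m n} g → m ≤ n → ∑< m (λ u → g ((n ∸ m) + u)) ≡ ∑< m (g ∘ mirror n)
∑<-block-mirror {m} {n} g m≤n =
  trans (sym (∑<-mirror m (λ u → g ((n ∸ m) + u)))) (∑<-cong m (λ t t<m → cong g (block-mirror t<m)))
  where
  block-mirror : ∀ {t} → t < m → (n ∸ m) + mirror m t ≡ mirror n t
  block-mirror {t} t<m = trans (sym (+-∸-assoc (n ∸ m) t<m)) (cong (_∸ suc t) (m∸n+n≡m m≤n))

∑<-bsmMargin-prefix : ∀ {n a m} → (∀ r → a r ≤ 1) → m ≤ n →
                      ∑< m (bsmMargin n a) + ∑< m a ≡ ∑< m (λ r → r + 1 + 2)
∑<-bsmMargin-prefix {n} {a} {m} a-binary m≤n = trans (sym (∑<-+ m (bsmMargin n a) a))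
  (∑<-cong m (λ r r<m → bsmMargin-inner (a-binary r) (<-≤-trans r<m m≤n)))

∑<-bsmMargin : ∀ {n a} → (∀ r → a r ≤ 1) →
               ∑< (n + 2) (bsmMargin n a) + ∑< n a ≡ ∑< n (λ r → r + 1 + 2) + 2 * (n + 2)
∑<-bsmMargin {n} {a} a-binary = begin
  ∑< (n + 2) (bsmMargin n a) + ∑< n a                   ≡⟨ cong (_+ ∑< n a) (∑<-split n 2 (bsmMargin n a)) ⟩
  ∑< n (bsmMargin n a) + border + ∑< n a                ≡⟨ xy∙z≈xz∙y (∑< n (bsmMargin n a)) border (∑< n a) ⟩
  ∑< n (bsmMargin n a) + ∑< n a + border                ≡⟨ cong₂ _+_ (∑<-bsmMargin-prefix {n} a-binary ≤-refl) border≡ ⟩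
  ∑< n (λ r → r + 1 + 2) + 2 * (n + 2)                  ∎
  where
  open ≡-Reasoning
  border = ∑< 2 (λ u → bsmMargin n a (n + u))
  border≡ : border ≡ 2 * (n + 2)
  border≡ = trans (∑<-cong 2 (λ u _ → bsmMargin-outer {a = a} (m≤m+n n u))) (∑<-const 2 (n + 2))

bsmMargin-block : ∀ {n a m u} → a ((n ∸ m) + u) ≤ 1 → m ≤ n → u < m →
                  (bsmMargin n a ((n ∸ m) + u) ∸ ((n + 2) ∸ m)) + a ((n ∸ m) + u) ≡ suc u
bsmMargin-block {n} {a} {m} {u} a≤1 m≤n u<m =
  ∸-+-cancel (trans (bsmMargin-inner a≤1 r<n) shift) (≤-trans a≤1 (s≤s z≤n))
  where
  r<n : (n ∸ m) + u < n
  r<n = subst ((n ∸ m) + u <_) (m∸n+n≡m m≤n) (+-monoʳ-< (n ∸ m) u<m)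
  rearrange : ∀ k u → k + u + 1 + 2 ≡ k + 2 + suc u
  rearrange = solve-∀
  shift : (n ∸ m) + u + 1 + 2 ≡ (n + 2) ∸ m + suc u
  shift = trans (rearrange (n ∸ m) u) (cong (_+ suc u) (sym (+-∸-comm 2 m≤n)))

module _ {n a b} (a-binary : ∀ r → a r ≤ 1) (b-binary : ∀ r → b r ≤ 1)
         (M : BinaryMatrix (n + 2) (bsmMargin n a) (bsmMargin n b)) where

  bsm-∑a≡∑b : ∑< n a ≡ ∑< n b
  bsm-∑a≡∑b = +-cancelˡ-≡ (∑< (n + 2) (bsmMargin n a)) (∑< n a) (∑< n b) (begin
    ∑< (n + 2) (bsmMargin n a) + ∑< n a    ≡⟨ ∑<-bsmMargin {n} a-binary ⟩
    ∑< n (λ r → r + 1 + 2) + 2 * (n + 2)   ≡⟨ sym (∑<-bsmMargin {n} b-binary) ⟩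
    ∑< (n + 2) (bsmMargin n b) + ∑< n b    ≡⟨ cong (_+ ∑< n b) (sym (∑rowSums≡∑colSums M)) ⟩
    ∑< (n + 2) (bsmMargin n a) + ∑< n b    ∎)
    where open ≡-Reasoning

  bsm-dominance : ∀ {m} → m ≤ n → ∑< m b ≤ ∑< m (a ∘ mirror n)
  bsm-dominance {m} m≤n = begin
    ∑< m b                   ≤⟨ ≤-from-sums E+∑a≡ ∑b-margins E+m*2≤ ⟩
    ∑< m (a ∘ block)         ≡⟨ ∑<-block-mirror a m≤n ⟩
    ∑< m (a ∘ mirror n)      ∎
    where
    open ≤-Reasoning
    m≤N : m ≤ n + 2
    m≤N = ≤-trans m≤n (m≤m+n n 2)
    block : ℕ → ℕ
    block u = (n ∸ m) + u
    excess : ℕ → ℕ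
    excess r = bsmMargin n a r ∸ ((n + 2) ∸ m)
    E+∑a≡ : ∑< m (excess ∘ block) + ∑< m (a ∘ block) ≡ ∑< m suc
    E+∑a≡ = trans (sym (∑<-+ m (excess ∘ block) (a ∘ block)))
                  (∑<-cong m (λ u u<m → bsmMargin-block (a-binary (block u)) m≤n u<m))
    ∑b-margins : ∑< m (bsmMargin n b) + ∑< m b ≡ ∑< m suc + m * 2
    ∑b-margins = begin-equality
      ∑< m (bsmMargin n b) + ∑< m b          ≡⟨ ∑<-bsmMargin-prefix b-binary m≤n ⟩
      ∑< m (λ r → r + 1 + 2)                 ≡⟨ ∑<-cong m (λ r _ → cong (_+ 2) (+-comm r 1)) ⟩
      ∑< m (λ r → suc r + 2)                 ≡⟨ ∑<-+ m suc (λ _ → 2) ⟩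
      ∑< m suc + ∑< m (λ _ → 2)              ≡⟨ cong (∑< m suc +_) (∑<-const m 2) ⟩
      ∑< m suc + m * 2                       ∎
    border : ∑< 2 (λ u → excess (n + u)) ≡ m * 2
    border = trans (∑<-cong 2 (λ u _ → trans (cong (_∸ ((n + 2) ∸ m)) (bsmMargin-outer {a = a} (m≤m+n n u)))
                                             (m∸[m∸n]≡n m≤N)))
                   (trans (∑<-const 2 m) (*-comm 2 m))
    E+m*2≤ : ∑< m (excess ∘ block) + m * 2 ≤ ∑< m (bsmMargin n b)
    E+m*2≤ = begin
      ∑< m (excess ∘ block) + m * 2                   ≤⟨ +-monoˡ-≤ (m * 2) (∑<-block≤ excess m≤n) ⟩
      ∑< n excess + m * 2                             ≡⟨ cong (∑< n excess +_) (sym border) ⟩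
      ∑< n excess + ∑< 2 (λ u → excess (n + u))       ≡⟨ sym (∑<-split n 2 excess) ⟩
      ∑< (n + 2) excess                               ≤⟨ ∑rowSums∸≤∑colSums M m≤N ⟩
      ∑< m (bsmMargin n b)                            ∎

module _ {n a b} (a-binary : ∀ r → a r ≤ 1) (b-binary : ∀ r → b r ≤ 1) (∑a≡∑b : ∑< n a ≡ ∑< n b)
         (b≼a∘mirror : ∀ {m} → m ≤ n → ∑< m b ≤ ∑< m (a ∘ mirror n)) where

  open Staircase (a-binary ∘ mirror n) b-binary (trans (∑<-mirror n a) ∑a≡∑b) b≼a∘mirror

  -- Rows are mirrored so that row r < n of the staircase has r + 1 ones before the matching is removed.
  bsm-binaryMatrix : BinaryMatrix (n + 2) (bsmMargin n a) (bsmMargin n b)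
  bsm-binaryMatrix = record
    { entry   = bordered n H
    ; binary  = bordered-binary n (staircase-binary ∘ mirror n)
    ; rowSums = λ {r} _ → rowSum≡ r
    ; colSums = λ {c} _ → colSum≡ c
    }
    where
    H : ℕ → ℕ → ℕ
    H = staircase ∘ mirror n
    rowSum≡ : ∀ r → ∑< (n + 2) (bordered n H r) ≡ bsmMargin n a r
    rowSum≡ r with n ≤? r
    ... | yes n≤r = trans (∑<-bordered-outer n≤r) (sym (bsmMargin-outer n≤r))
    ... | no  n≰r = trans (∑<-bordered-inner r<n) (bsmMargin-from (a-binary r) r<n row)
      where
      r<n = ≰⇒> n≰r
      open ≡-Reasoning
      row : ∑< n (H r) + a r ≡ suc r
      row = begin
        ∑< n (H r) + a r                         ≡⟨ cong (λ t → ∑< n (H r) + a t) (sym (mirror-involutive r<n)) ⟩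
        ∑< n (H r) + a (mirror n (mirror n r))   ≡⟨ ∑<-staircase-row (mirror< r<n) ⟩
        n ∸ mirror n r                           ≡⟨ m∸[m∸n]≡n r<n ⟩
        suc r                                    ∎
    colSum≡ : ∀ c → ∑< (n + 2) (λ r → bordered n H r c) ≡ bsmMargin n b c
    colSum≡ c with n ≤? c
    ... | yes n≤c = trans (∑<-bordered-transpose n (n + 2) H c)
                          (trans (∑<-bordered-outer n≤c) (sym (bsmMargin-outer n≤c)))
    ... | no  n≰c = trans (∑<-bordered-transpose n (n + 2) H c)
                          (trans (∑<-bordered-inner c<n) (bsmMargin-from (b-binary c) c<n col))
      where
      c<n = ≰⇒> n≰c
      col : ∑< n (λ r → H r c) + b c ≡ suc c
      col = trans (cong (_+ b c) (∑<-mirror n (λ t → staircase t c))) (∑<-staircase-col c<n)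

SkewMirrorCondition : ℕ → (ℕ → ℕ) → (ℕ → ℕ) → Set
SkewMirrorCondition n a b = ∑< n a ≡ ∑< n b × (∀ {m} → m ≤ n → ∑< m b ≤ ∑< m (a ∘ mirror n))

bsm-binaryMatrix⇔ : ∀ {n a b} → (∀ r → a r ≤ 1) → (∀ r → b r ≤ 1) →
                    BinaryMatrix (n + 2) (bsmMargin n a) (bsmMargin n b) ⇔ SkewMirrorCondition n a b
bsm-binaryMatrix⇔ {n} {a} {b} a-binary b-binary = mk⇔
  (λ M → bsm-∑a≡∑b a-binary b-binary M , λ {m} → bsm-dominance a-binary b-binary M {m}) construct
  where
  construct : SkewMirrorCondition n a b → BinaryMatrix (n + 2) (bsmMargin n a) (bsmMargin n b)
  construct (∑a≡∑b , b≼a∘mirror) = bsm-binaryMatrix a-binary b-binary ∑a≡∑b b≼a∘mirror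

extend : ∀ {N} → (Fin N → ℕ) → ℕ → ℕ
extend {zero}  f _       = 0
extend {suc N} f zero    = f zero
extend {suc N} f (suc r) = extend (f ∘ suc) r

extend-toℕ : ∀ {N} (f : Fin N → ℕ) i → extend f (toℕ i) ≡ f i
extend-toℕ f zero    = refl
extend-toℕ f (suc i) = extend-toℕ (f ∘ suc) i

extend-binary : ∀ {N} {f : Fin N → ℕ} → (∀ i → f i ≤ 1) → ∀ r → extend f r ≤ 1
extend-binary {zero}  _   _       = z≤n
extend-binary {suc N} f≤1 zero    = f≤1 zero
extend-binary {suc N} f≤1 (suc r) = extend-binary (f≤1 ∘ suc) r

∀<-from-toℕ : ∀ {N} {P : ℕ → Set} → (∀ (i : Fin N) → P (toℕ i)) → ∀ {r} → r < N → P r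
∀<-from-toℕ {P = P} P∘toℕ r<N = subst P (toℕ-fromℕ< r<N) (P∘toℕ (fromℕ< r<N))

Σ-cong : ∀ {N} {f g : Fin N → ℕ} → (∀ i → f i ≡ g i) → Σ[ f ] ≡ Σ[ g ]
Σ-cong {zero}  _   = refl
Σ-cong {suc N} f≡g = cong₂ _+_ (f≡g zero) (Σ-cong (f≡g ∘ suc))

Σ≡∑<extend : ∀ {N} (f : Fin N → ℕ) → Σ[ f ] ≡ ∑< N (extend f)
Σ≡∑<extend f = Σ-cong (λ i → sym (extend-toℕ f i))

∑<-truncate : ∀ {N k} g → k ≤ N → ∑< N (λ m → 𝟙[ m <? k ] * g m) ≡ ∑< k g
∑<-truncate {N} {k} g k≤N = begin
  ∑< N h                                        ≡⟨ ∑<-split∸ h k≤N ⟩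
  ∑< k h + ∑< (N ∸ k) (λ u → h (k + u))         ≡⟨ cong₂ _+_ (∑<-cong k kept) (∑<-cong (N ∸ k) dropped) ⟩
  ∑< k g + ∑< (N ∸ k) (λ _ → 0)                 ≡⟨ cong (∑< k g +_) (∑<-zeros (N ∸ k)) ⟩
  ∑< k g + 0                                    ≡⟨ +-identityʳ (∑< k g) ⟩
  ∑< k g                                        ∎
  where
  open ≡-Reasoning
  h : ℕ → ℕ
  h m = 𝟙[ m <? k ] * g m
  kept : ∀ m → m < k → h m ≡ g m
  kept m m<k = trans (cong (_* g m) (𝟙-yes {d = m <? k} m<k)) (*-identityˡ (g m))
  dropped : ∀ u → u < N ∸ k → h (k + u) ≡ 0
  dropped u _ = cong (_* g (k + u)) (𝟙-no {d = k + u <? k} (m+n≮m k u))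

mutual
  prefix≡∑< : ∀ {n} (f : Fin n → ℕ) {k} → k ≤ n → prefix f k ≡ ∑< k (extend f)
  prefix≡∑< f {k} k≤n = trans (Σ-cong (prefix-summand f k)) (∑<-truncate (extend f) k≤n)

  -- `_` is the test toℕ i < k local to Defs.prefix, which cannot be named here; it is solved
  -- by the use in prefix≡∑<.
  prefix-summand : ∀ {n} (f : Fin n → ℕ) k i → (if _ then f i else 0) ≡ 𝟙[ toℕ i <? k ] * extend f (toℕ i)
  prefix-summand f k i with toℕ i <? k
  ... | yes _ = sym (trans (+-identityʳ (extend f (toℕ i))) (extend-toℕ f i))
  ... | no _  = refl

prefix-rev : ∀ {n} (α : Fin n → ℕ) {k} → k ≤ n → prefix (rev α) k ≡ ∑< k (extend α ∘ mirror n)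
prefix-rev {n} α {k} k≤n =
  trans (prefix≡∑< (rev α) k≤n)
        (∑<-cong k (λ t t<k → ∀<-from-toℕ {P = reversed} reversed-toℕ (<-≤-trans t<k k≤n)))
  where
  reversed : ℕ → Set
  reversed t = extend (rev α) t ≡ extend α (mirror n t)
  reversed-toℕ : ∀ i → reversed (toℕ i)
  reversed-toℕ i = trans (extend-toℕ (rev α) i)
                         (trans (sym (extend-toℕ α (opposite i))) (cong (extend α) (opposite-prop i)))

Σ≡Σ⇔ : ∀ {N} (f g : Fin N → ℕ) → (Σ[ f ] ≡ Σ[ g ]) ⇔ (∑< N (extend f) ≡ ∑< N (extend g))
Σ≡Σ⇔ f g = mk⇔ (λ Σf≡Σg → trans (sym (Σ≡∑<extend f)) (trans Σf≡Σg (Σ≡∑<extend g)))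
               (λ ∑f≡∑g → trans (Σ≡∑<extend f) (trans ∑f≡∑g (sym (Σ≡∑<extend g))))

⪯-rev⇔ : ∀ {n} (α β : Fin n → ℕ) →
         β ⪯ rev α ⇔ (∀ {m} → m ≤ n → ∑< m (extend β) ≤ ∑< m (extend α ∘ mirror n))
⪯-rev⇔ α β = mk⇔
  (λ β⪯revα {m} m≤n → subst₂ _≤_ (prefix≡∑< β m≤n) (prefix-rev α m≤n) (β⪯revα m m≤n))
  (λ β≼ m m≤n → subst₂ _≤_ (sym (prefix≡∑< β m≤n)) (sym (prefix-rev α m≤n)) (β≼ m≤n))

beige : Cell → ℕ
beige c = if isAtom B c then 1 else 0

beige-binary : ∀ c → beige c ≤ 1
beige-binary (atom A) = z≤n
beige-binary (atom B) = s≤s z≤n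
beige-binary (atom C) = z≤n
beige-binary empty    = z≤n

beigeCell : ℕ → Cell
beigeCell zero    = empty
beigeCell (suc _) = atom B

beige-beigeCell : ∀ {x} → x ≤ 1 → beige (beigeCell x) ≡ x
beige-beigeCell z≤n       = refl
beige-beigeCell (s≤s z≤n) = refl

isAtom-beigeCell : ∀ {a} → a ≢ B → ∀ x → isAtom a (beigeCell x) ≡ false
isAtom-beigeCell     _   zero    = refl
isAtom-beigeCell {A} _   (suc _) = refl
isAtom-beigeCell {B} a≢B (suc _) = contradiction refl a≢B
isAtom-beigeCell {C} _   (suc _) = refl

count-beigeCell : ∀ {a N} → a ≢ B → (x : Fin N → ℕ) → count (λ j → isAtom a (beigeCell (x j))) ≡ 0
count-beigeCell {N = N} a≢B x =
  trans (Σ-cong (λ j → cong (λ b → if b then 1 else 0) (isAtom-beigeCell a≢B (x j))))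
        (∑<-zeros N)

beigeLayer : ∀ {N} → Matrix N → ℕ → ℕ → ℕ
beigeLayer M r c = extend (λ i → extend (λ j → beige (M i j)) c) r

beigeLayer-toℕ : ∀ {N} (M : Matrix N) i j → beigeLayer M (toℕ i) (toℕ j) ≡ beige (M i j)
beigeLayer-toℕ M i j = trans (extend-toℕ _ i) (extend-toℕ (λ j → beige (M i j)) j)

bsmSum≡bsmMargin : ∀ n (α : Fin n → ℕ) k → bsmSum n α k ≡ bsmMargin n (extend α) (toℕ k)
bsmSum≡bsmMargin n α k with toℕ k <? n
... | yes k<n = cong (toℕ k + 1 + 2 ∸_)
                  (trans (sym (extend-toℕ α (fromℕ< k<n))) (cong (extend α) (toℕ-fromℕ< k<n)))
... | no _    = refl

consistent⇔binaryMatrix : ∀ n (α β : Fin n → ℕ) →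
  Consistent (BSM n α β) ⇔ BinaryMatrix (n + 2) (bsmMargin n (extend α)) (bsmMargin n (extend β))
consistent⇔binaryMatrix n α β = mk⇔ beigeMatrix realize
  where
  beigeMatrix : Consistent (BSM n α β) → BinaryMatrix (n + 2) (bsmMargin n (extend α)) (bsmMargin n (extend β))
  beigeMatrix (M , rows , cols) = record
    { entry   = beigeLayer M
    ; binary  = λ r c → extend-binary (λ i → extend-binary (λ j → beige-binary (M i j)) c) r
    ; rowSums = ∀<-from-toℕ {P = λ r → ∑< (n + 2) (beigeLayer M r) ≡ bsmMargin n (extend α) r} row
    ; colSums = ∀<-from-toℕ {P = λ c → ∑< (n + 2) (λ r → beigeLayer M r c) ≡ bsmMargin n (extend β) c} col
    }
    where
    row : ∀ i → ∑< (n + 2) (beigeLayer M (toℕ i)) ≡ bsmMargin n (extend α) (toℕ i)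
    row i = trans (Σ-cong (beigeLayer-toℕ M i)) (trans (rows B i) (bsmSum≡bsmMargin n α i))
    col : ∀ j → ∑< (n + 2) (λ r → beigeLayer M r (toℕ j)) ≡ bsmMargin n (extend β) (toℕ j)
    col j = trans (Σ-cong (λ i → beigeLayer-toℕ M i j)) (trans (cols B j) (bsmSum≡bsmMargin n β j))
  realize : BinaryMatrix (n + 2) (bsmMargin n (extend α)) (bsmMargin n (extend β)) → Consistent (BSM n α β)
  realize F = M , rows , cols
    where
    open BinaryMatrix F
    M : Matrix (n + 2)
    M i j = beigeCell (entry (toℕ i) (toℕ j))
    rows : ∀ a i → count (λ j → isAtom a (M i j)) ≡ rowSum (BSM n α β) a i
    rows A i = count-beigeCell {A} {n + 2} (λ ()) (entry (toℕ i) ∘ toℕ)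
    rows B i = trans (Σ-cong {n + 2} (λ j → beige-beigeCell (binary (toℕ i) (toℕ j))))
                     (trans (rowSums (toℕ<n i)) (sym (bsmSum≡bsmMargin n α i)))
    rows C i = count-beigeCell {C} {n + 2} (λ ()) (entry (toℕ i) ∘ toℕ)
    cols : ∀ a j → count (λ i → isAtom a (M i j)) ≡ colSum (BSM n α β) a j
    cols A j = count-beigeCell {A} {n + 2} (λ ()) (λ i → entry (toℕ i) (toℕ j))
    cols B j = trans (Σ-cong {n + 2} (λ i → beige-beigeCell (binary (toℕ i) (toℕ j))))
                     (trans (colSums (toℕ<n j)) (sym (bsmSum≡bsmMargin n β j)))
    cols C j = count-beigeCell {C} {n + 2} (λ ()) (λ i → entry (toℕ i) (toℕ j))

lemma6 : (n : ℕ) → 1 ≤ n → (α β : Fin n → ℕ) → ZeroOne α → ZeroOne β →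
         Consistent (BSM n α β) ⇔ ((Σ[ α ] ≡ Σ[ β ]) × (β ⪯ rev α))
lemma6 n _ α β α-binary β-binary =
  ⇔-trans (consistent⇔binaryMatrix n α β)
  (⇔-trans (bsm-binaryMatrix⇔ (extend-binary α-binary) (extend-binary β-binary))
           (⇔-sym (Σ≡Σ⇔ α β ×-⇔ ⪯-rev⇔ α β)))
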